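{- Let $\mathcal{X}$ be a connected $n$-premaniplex with base flag $x_0$, $N=\mathrm{Stab}_{\mathcal{C}^n}(x_0)$, and let $(\mathcal{Y},\eta)$ be an $(n,m)$-voltage operator with $\mathcal{Y}$ connected, base flag $y_0$ and $L=\mathrm{Stab}_{\mathcal{C}^m}(y_0)$. Let $\zeta:L\to\mathcal{C}^n$ be $\zeta(\omega)=\eta(P_\omega(y_0))$. Then $\mathrm{Stab}_{\mathcal{C}^m}((x_0,y_0))=\zeta^{ -1}(N)$. In particular, if $\mathcal{X}\rtimes_\eta\mathcal{Y}$ is connected, it is isomorphic to the coset premaniplex $\mathcal{C}^m/\zeta^{ -1}(N)$ via an isomorphism sending $(x_0,y_0)$ to the coset $\zeta^{ -1}(N)$.
   Context: A graph may have multiple edges and semi-edges. An $n$-premaniplex is such a graph with edges coloured by $\{0,\dots,n-1\}$ so that every vertex (flag) is the starting point of exactly one dart of each colour, and whenever $|i-j|\ge2$ every alternating path of length 4 with colours $i,j$ is closed; $x^i$ is the end of the $i$-dart at $x$. $\mathcal{C}^n=\langle r_0,\dots,r_{n-1}\mid r_i^2=1,\ (r_ir_j)^2=1\ (|i-j|\ge2)\rangle$ acts on the left on flags by $r_ix=x^i$; $\mathrm{Stab}$ denotes stabilisers for this action. For a flag $y$ of an $m$-premaniplex $\mathcal{Y}$ and $\omega\in\mathcal{C}^m$, $P_\omega(y)$ is the homotopy class of paths from $y$ whose successive colours $i_1,\dots,i_k$ satisfy $r_{i_k}\cdots r_{i_1}=\omega$ (paths are homotopic iff same start and same element of $\mathcal{C}^m$);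 they end at $\omega y$; these form the fundamental groupoid $\Pi(\mathcal{Y})$. A voltage assignment $\eta:\Pi(\mathcal{Y})\to\mathcal{C}^n$ satisfies $\eta(W_1W_2)=\eta(W_2)\eta(W_1)$; $(\mathcal{Y},\eta)$ is an $(n,m)$-voltage operator. $\mathcal{X}\rtimes_\eta\mathcal{Y}$ is the $m$-premaniplex with flags $\mathcal{X}\times\mathcal{Y}$ and $(x,y)^i=(\eta(P_{r_i}(y))x,y^i)$, so $\omega(x,y)=(\eta(P_\omega(y))x,\omega y)$. For $K\le\mathcal{C}^m$, the coset premaniplex $\mathcal{C}^m/K$ has flags the left cosets $\omega K$ with $i$-adjacency $\omega K\mapsto r_i\omega K$; an isomorphism is a bijection of flags preserving all $i$-adjacencies. Standing assumption: $\mathcal{Y}$ has a spanning tree all of whose darts have trivial voltage. -}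

module Defs where

open import Data.Nat using (ℕ; _+_; _≤_)
open import Data.Fin using (Fin; toℕ)
open import Data.List using (List; []; _∷_; _++_; reverse)
open import Data.Product using (Σ; _×_; _,_; ∃)
open import Data.Sum using (_⊎_)
open import Relation.Binary.PropositionalEquality using (_≡_)

-- The Coxeter group C^n, presented by words in the generators r_0..r_{n-1}.
-- A word  a₁ ∷ a₂ ∷ … ∷ aₖ ∷ []  denotes the group element r_{a₁} r_{a₂} ⋯ r_{aₖ}.
-- Hence the group product ω ω' is  ω ++ ω',  the identity is [],
-- and the inverse of a word is its reverse (generators are involutions).

Word : ℕ → Set
Word n = List (Fin n)

Far : ∀ {n} → Fin n → Fin n → Set
Far i j = (2 + toℕ i ≤ toℕ j) ⊎ (2 + toℕ j ≤ toℕ i)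

infix 4 _≈_
data _≈_ {n : ℕ} : Word n → Word n → Set where
  ≈-refl  : ∀ {w} → w ≈ w
  ≈-sym   : ∀ {w w'} → w ≈ w' → w' ≈ w
  ≈-trans : ∀ {u v w} → u ≈ v → v ≈ w → u ≈ w
  rel-sq  : ∀ u v (i : Fin n) → (u ++ i ∷ i ∷ v) ≈ (u ++ v)
  rel-far : ∀ u v (i j : Fin n) → Far i j →
            (u ++ i ∷ j ∷ i ∷ j ∷ v) ≈ (u ++ v)

inv : ∀ {n} → Word n → Word n
inv = reverse

-- Edge-coloured graphs (multiple edges and semi-edges allowed):
-- every flag is the start of exactly one dart of each colour.

record ColGraph (n : ℕ) : Set₁ where
  field
    Flag : Set
    adj  : Fin n → Flag → Flag

  act : Word n → Flag → Flag
  act []      x = x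
  act (i ∷ w) x = adj i (act w x)

open ColGraph public

record IsPremaniplex {n : ℕ} (G : ColGraph n) : Set where
  field
    invol : ∀ i x → adj G i (adj G i x) ≡ x
    comm  : ∀ i j x → Far i j →
            adj G i (adj G j (adj G i (adj G j x))) ≡ x

record Premaniplex (n : ℕ) : Set₁ where
  field
    graph : ColGraph n
    isPremaniplex : IsPremaniplex graph

open Premaniplex public

Connected : ∀ {n} → ColGraph n → Set
Connected G = ∀ x y → ∃ λ (w : Word _) → act G w x ≡ y

Stab : ∀ {n} (G : ColGraph n) → Flag G → Word n → Set
Stab G x w = act G w x ≡ x

-- Voltage assignments on the fundamental groupoid Π(Y).
-- The homotopy class P_ω(y) is represented by the pair (y, ω); it ends at ω y.
-- η(P_ω(y)) is written  η y ω.  Concatenation P_ω(y) · P_ω'(ω y) = P_{ω'ω}(y),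
-- and η(W₁W₂) = η(W₂)η(W₁) gives  η y (ω' ω) = η (ω y) ω' · η y ω.

record VoltageAssignment {n m : ℕ} (Y : ColGraph m) : Set₁ where
  field
    η     : Flag Y → Word m → Word n
    resp  : ∀ y {w w'} → w ≈ w' → η y w ≈ η y w'
    mult  : ∀ y w w' → η y (w' ++ w) ≈ (η (act Y w y) w' ++ η y w)

open VoltageAssignment public

record VoltageOperator (n m : ℕ) : Set₁ where
  field
    Y   : Premaniplex m
    vol : VoltageAssignment {n} {m} (graph Y)

open VoltageOperator public

_⋊_ : ∀ {n m} → Premaniplex n → VoltageOperator n m → ColGraph m
Flag (X ⋊ O) = Flag (graph X) × Flag (graph (Y O))
adj  (X ⋊ O) i (x , y) =
  act (graph X) (η (vol O) y (i ∷ [])) x , adj (graph (Y O)) i y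

ζ : ∀ {n m} (O : VoltageOperator n m) (y₀ : Flag (graph (Y O))) →
    Σ (Word m) (Stab (graph (Y O)) y₀) → Word n
ζ O y₀ (w , _) = η (vol O) y₀ w

ζ⁻¹N : ∀ {n m} (X : Premaniplex n) (x₀ : Flag (graph X))
       (O : VoltageOperator n m) (y₀ : Flag (graph (Y O))) → Word m → Set
ζ⁻¹N X x₀ O y₀ w =
  Σ (Stab (graph (Y O)) y₀ w) λ p → Stab (graph X) x₀ (ζ O y₀ (w , p))

-- Coset premaniplex C^m / K: flags are left cosets ω K (ω K = ω' K iff
-- ω⁻¹ ω' ∈ K), i-adjacency ω K ↦ r_i ω K.  Since quotients are not
-- available, cosets are represented by words up to the relation _∼[ K ]_.

_∼[_]_ : ∀ {m} → Word m → (Word m → Set) → Word m → Set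
w ∼[ K ] w' = K (inv w ++ w')

record CosetIso {m : ℕ} (G : ColGraph m) (b : Flag G) (K : Word m → Set) : Set where
  field
    to        : Flag G → Word m
    from      : Word m → Flag G
    from-resp : ∀ {w w'} → w ∼[ K ] w' → from w ≡ from w'
    from-to   : ∀ f → from (to f) ≡ f
    to-from   : ∀ w → to (from w) ∼[ K ] w
    to-adj    : ∀ i f → to (adj G i f) ∼[ K ] (i ∷ to f)
    to-base   : to b ∼[ K ] []

{-# OPTIONS --safe #-}
module Submission where

-- The action of C^m on X ⋊ Y is ω (x , y) = (η(P_ω(y)) x , ω y), so ω fixes (x₀ , y₀) exactly when
-- it fixes y₀ and ζ(ω) fixes x₀. The product is again a premaniplex, and a connected premaniplex is
-- the coset premaniplex of the stabiliser of any of its flags (orbit–stabiliser).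

open import Defs
open import Data.Product using (_×_; _,_; proj₁; proj₂)
open import Data.Product.Properties using (,-injectiveˡ; ,-injectiveʳ)
open import Data.List using ([]; _∷_; _++_; _∷ʳ_)
open import Data.List.Properties using (reverse-involutive; unfold-reverse)
open import Function.Bundles using (_⇔_; mk⇔; Equivalence)
open import Relation.Binary.PropositionalEquality hiding (resp)
open ≡-Reasoning

act-++ : ∀ {n} (G : ColGraph n) u v x → act G (u ++ v) x ≡ act G u (act G v x)
act-++ G []      v x = refl
act-++ G (i ∷ u) v x = cong (adj G i) (act-++ G u v x)

module _ {n} {G : ColGraph n} (P : IsPremaniplex G) where
  open IsPremaniplex P

  act-inv-act : ∀ w x → act G (inv w) (act G w x) ≡ x
  act-inv-act []      x = refl
  act-inv-act (i ∷ w) x = begin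
    act G (inv (i ∷ w)) (act G (i ∷ w) x)    ≡⟨ cong (λ u → act G u (act G (i ∷ w) x)) (unfold-reverse i w) ⟩
    act G (inv w ∷ʳ i) (act G (i ∷ w) x)     ≡⟨ act-++ G (inv w) (i ∷ []) _ ⟩
    act G (inv w) (adj G i (adj G i _))       ≡⟨ cong (act G (inv w)) (invol i _) ⟩
    act G (inv w) (act G w x)                 ≡⟨ act-inv-act w x ⟩
    x                                         ∎

  act-act-inv : ∀ w x → act G w (act G (inv w) x) ≡ x
  act-act-inv w x = begin
    act G w (act G (inv w) x)                 ≡⟨ cong (λ u → act G u (act G (inv w) x)) (reverse-involutive w) ⟨
    act G (inv (inv w)) (act G (inv w) x)     ≡⟨ act-inv-act (inv w) x ⟩
    x                                         ∎

  act-injective : ∀ w {x x'} → act G w x ≡ act G w x' → x ≡ x'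
  act-injective w {x} {x'} e = begin
    x                                         ≡⟨ act-inv-act w x ⟨
    act G (inv w) (act G w x)                 ≡⟨ cong (act G (inv w)) e ⟩
    act G (inv w) (act G w x')                ≡⟨ act-inv-act w x' ⟩
    x'                                        ∎

  act-resp-≈ : ∀ {w w'} → w ≈ w' → ∀ x → act G w x ≡ act G w' x
  act-resp-≈ ≈-refl          x = refl
  act-resp-≈ (≈-sym p)       x = sym (act-resp-≈ p x)
  act-resp-≈ (≈-trans p q)   x = trans (act-resp-≈ p x) (act-resp-≈ q x)
  act-resp-≈ (rel-sq u v i)  x = begin
    act G (u ++ i ∷ i ∷ v) x                  ≡⟨ act-++ G u _ x ⟩
    act G u (adj G i (adj G i (act G v x)))   ≡⟨ cong (act G u) (invol i _) ⟩
    act G u (act G v x)                       ≡⟨ act-++ G u v x ⟨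
    act G (u ++ v) x                          ∎
  act-resp-≈ (rel-far u v i j far) x = begin
    act G (u ++ i ∷ j ∷ i ∷ j ∷ v) x          ≡⟨ act-++ G u _ x ⟩
    act G u (act G (i ∷ j ∷ i ∷ j ∷ []) _)    ≡⟨ cong (act G u) (comm i j _ far) ⟩
    act G u (act G v x)                       ≡⟨ act-++ G u v x ⟨
    act G (u ++ v) x                          ∎

module _ {n m} (X : Premaniplex n) (O : VoltageOperator n m) where
  private
    GX = graph X
    GY = graph (Y O)
    V = vol O

  -- η y [] is an idempotent of C^n, hence acts as the identity.
  act-η-[] : ∀ y x → act GX (η V y []) x ≡ x
  act-η-[] y x = act-injective (isPremaniplex X) (η V y []) (begin
    act GX (η V y []) (act GX (η V y []) x)   ≡⟨ act-++ GX (η V y []) (η V y []) x ⟨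
    act GX (η V y [] ++ η V y []) x           ≡⟨ act-resp-≈ (isPremaniplex X) (mult V y [] []) x ⟨
    act GX (η V y []) x                       ∎)

  act-⋊ : ∀ w x y → act (X ⋊ O) w (x , y) ≡ (act GX (η V y w) x , act GY w y)
  act-⋊ []      x y = cong (_, y) (sym (act-η-[] y x))
  act-⋊ (i ∷ w) x y = begin
    adj (X ⋊ O) i (act (X ⋊ O) w (x , y))
      ≡⟨ cong (adj (X ⋊ O) i) (act-⋊ w x y) ⟩
    (act GX (η V (act GY w y) (i ∷ [])) (act GX (η V y w) x) , act GY (i ∷ w) y)
      ≡⟨ cong (_, act GY (i ∷ w) y) (act-++ GX (η V (act GY w y) (i ∷ [])) (η V y w) x) ⟨
    (act GX (η V (act GY w y) (i ∷ []) ++ η V y w) x , act GY (i ∷ w) y)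
      ≡⟨ cong (_, act GY (i ∷ w) y) (act-resp-≈ (isPremaniplex X) (mult V y w (i ∷ [])) x) ⟨
    (act GX (η V y (i ∷ w)) x , act GY (i ∷ w) y)
      ∎

  act-⋊-trivial : ∀ {w} → w ≈ [] → ∀ f → act (X ⋊ O) w f ≡ f
  act-⋊-trivial {w} w≈[] (x , y) = begin
    act (X ⋊ O) w (x , y)                     ≡⟨ act-⋊ w x y ⟩
    (act GX (η V y w) x , act GY w y)         ≡⟨ cong₂ _,_ (act-resp-≈ (isPremaniplex X) (resp V y w≈[]) x)
                                                         (act-resp-≈ (isPremaniplex (Y O)) w≈[] y) ⟩
    (act GX (η V y []) x , y)                 ≡⟨ cong (_, y) (act-η-[] y x) ⟩
    (x , y)                                   ∎

  ⋊-isPremaniplex : IsPremaniplex (X ⋊ O)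
  ⋊-isPremaniplex = record
    { invol = λ i → act-⋊-trivial (rel-sq [] [] i)
    ; comm  = λ i j f far → act-⋊-trivial (rel-far [] [] i j far) f
    }

  Stab-⋊⇔ζ⁻¹N : ∀ x y w → Stab (X ⋊ O) (x , y) w ⇔ ζ⁻¹N X x O y w
  Stab-⋊⇔ζ⁻¹N x y w = mk⇔
    (λ s → let s' = trans (sym (act-⋊ w x y)) s in ,-injectiveʳ s' , ,-injectiveˡ s')
    (λ (sy , sx) → trans (act-⋊ w x y) (cong₂ _,_ sx sy))

module _ {m} {G : ColGraph m} (P : IsPremaniplex G) (b : Flag G) where

  act-≡⇔∼Stab : ∀ w w' → act G w b ≡ act G w' b ⇔ (w ∼[ Stab G b ] w')
  act-≡⇔∼Stab w w' = mk⇔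
    (λ e → begin
      act G (inv w ++ w') b                   ≡⟨ act-++ G (inv w) w' b ⟩
      act G (inv w) (act G w' b)              ≡⟨ cong (act G (inv w)) e ⟨
      act G (inv w) (act G w b)               ≡⟨ act-inv-act P w b ⟩
      b                                       ∎)
    (λ s → begin
      act G w b                               ≡⟨ cong (act G w) s ⟨
      act G w (act G (inv w ++ w') b)         ≡⟨ cong (act G w) (act-++ G (inv w) w' b) ⟩
      act G w (act G (inv w) (act G w' b))    ≡⟨ act-act-inv P w _ ⟩
      act G w' b                              ∎)

  connected⇒CosetIso-Stab : Connected G → CosetIso G b (Stab G b)
  connected⇒CosetIso-Stab conn = record
    { to        = to
    ; from      = from
    ; from-resp = λ {w} {w'} → Equivalence.from (act-≡⇔∼Stab w w')
    ; from-to   = λ f → proj₂ (conn b f)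
    ; to-from   = λ w → to-∼ (from w) w refl
    ; to-adj    = λ i f → to-∼ (adj G i f) (i ∷ to f) (cong (adj G i) (sym (proj₂ (conn b f))))
    ; to-base   = to-∼ b [] refl
    }
    where
    to : Flag G → Word m
    to f = proj₁ (conn b f)
    from : Word m → Flag G
    from w = act G w b
    to-∼ : ∀ f w → f ≡ from w → to f ∼[ Stab G b ] w
    to-∼ f w e = Equivalence.to (act-≡⇔∼Stab (to f) w) (trans (proj₂ (conn b f)) e)

CosetIso-resp : ∀ {m} {G : ColGraph m} {b : Flag G} {K K' : Word m → Set} →
                (∀ w → K w ⇔ K' w) → CosetIso G b K → CosetIso G b K'
CosetIso-resp K⇔K' I = record
  { to        = to
  ; from      = from
  ; from-resp = λ k → from-resp (Equivalence.from (K⇔K' _) k)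
  ; from-to   = from-to
  ; to-from   = λ w → Equivalence.to (K⇔K' _) (to-from w)
  ; to-adj    = λ i f → Equivalence.to (K⇔K' _) (to-adj i f)
  ; to-base   = Equivalence.to (K⇔K' _) to-base
  }
  where open CosetIso I

lemma5p2 : ∀ {n m} (X : Premaniplex n) (x₀ : Flag (graph X)) → Connected (graph X) →
           (O : VoltageOperator n m) (y₀ : Flag (graph (Y O))) → Connected (graph (Y O)) →
           (∀ w → Stab (X ⋊ O) (x₀ , y₀) w ⇔ ζ⁻¹N X x₀ O y₀ w)
           × (Connected (X ⋊ O) → CosetIso (X ⋊ O) (x₀ , y₀) (ζ⁻¹N X x₀ O y₀))
lemma5p2 X x₀ _ O y₀ _ =
  stab , λ conn → CosetIso-resp stab (connected⇒CosetIso-Stab (⋊-isPremaniplex X O) (x₀ , y₀) conn)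
  where
  stab : ∀ w → Stab (X ⋊ O) (x₀ , y₀) w ⇔ ζ⁻¹N X x₀ O y₀ w
  stab = Stab-⋊⇔ζ⁻¹N X O x₀ y₀
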